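{- For every quiver $Q$ there are isomorphisms in $\mathfrak{Q}$, natural in $Q$: (1) $\Upsilon^{\diamond}\Upsilon(Q)\cong Q\times\overrightarrow{P}_1$; (2) $\Upsilon^{\star}\Upsilon(Q)\cong Q^{\overrightarrow{P}_1}$, where $Q^{\overrightarrow{P}_1}$ is the exponential object in the topos $\mathfrak{Q}$.
   Context: A quiver $Q$ consists of sets $\overrightarrow{V}(Q)$, $\overrightarrow{E}(Q)$ and functions $\sigma_Q,\tau_Q:\overrightarrow{E}(Q)\to\overrightarrow{V}(Q)$; morphisms are pairs of functions commuting with $\sigma,\tau$; category $\mathfrak{Q}$ (a presheaf topos), products componentwise. $\overrightarrow{P}_1$ is the quiver with two vertices and one edge from one to the other. An incidence hypergraph $G$ consists of sets $\check V(G)$, $\check E(G)$, $I(G)$ and functions $\varsigma_G:I(G)\to\check V(G)$, $\omega_G:I(G)\to\check E(G)$; morphisms are triples of functions commuting with $\varsigma,\omega$; category $\mathfrak{R}$. $\Upsilon(Q)$ is the incidence hypergraph with $\check V=\check E=\overrightarrow{V}(Q)$, $I=\overrightarrow{E}(Q)$, $\varsigma=\sigma_Q$, $\omega=\tau_Q$, and $\Upsilon(\phi)=(\overrightarrow{V}(\phi),\overrightarrow{V}(\phi),\overrightarrow{E}(\phi))$. $\Upsilon^{\diamond}(G)$ is the quiver with vertex set $\check V(G)\sqcup\check E(G)$, edge set $I(G)$, source $\varsigma_G$ and target $\omega_G$ (composed with the inclusions); $\Upsilon^{\star}(G)$ is the quiver with vertices $\check V(G)\times\check E(G)$, edges $\check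 V(G)\times I(G)\times\check E(G)$, source $(v,i,e)\mapsto(\varsigma_G(i),e)$, target $(v,i,e)\mapsto(v,\omega_G(i))$. These are the left and right adjoints of $\Upsilon$. -}

module Defs where

open import Data.Bool using (Bool; true; false)
open import Data.Unit using (⊤; tt)
open import Data.Product using (Σ; _×_; _,_; proj₁; proj₂)
open import Data.Sum using (_⊎_; inj₁; inj₂)
open import Relation.Binary.PropositionalEquality using (_≡_; refl; trans; cong)

record Quiver : Set₁ where
  field
    V   : Set
    E   : Set
    src : E → V
    tgt : E → V
open Quiver public

record QHom (Q R : Quiver) : Set where
  field
    hV   : V Q → V R
    hE   : E Q → E R
    hsrc : ∀ e → hV (src Q e) ≡ src R (hE e)
    htgt : ∀ e → hV (tgt Q e) ≡ tgt R (hE e)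
open QHom public

_≈Q_ : ∀ {Q R} → QHom Q R → QHom Q R → Set
f ≈Q g = (∀ v → hV f v ≡ hV g v) × (∀ e → hE f e ≡ hE g e)

idQ : ∀ {Q} → QHom Q Q
idQ = record { hV = λ v → v ; hE = λ e → e ; hsrc = λ _ → refl ; htgt = λ _ → refl }

_∘Q_ : ∀ {P Q R} → QHom Q R → QHom P Q → QHom P R
g ∘Q f = record
  { hV = λ v → hV g (hV f v)
  ; hE = λ e → hE g (hE f e)
  ; hsrc = λ e → trans (cong (hV g) (hsrc f e)) (hsrc g (hE f e))
  ; htgt = λ e → trans (cong (hV g) (htgt f e)) (htgt g (hE f e))
  }

record QIso (Q R : Quiver) : Set where
  field
    to      : QHom Q R
    from    : QHom R Q
    from∘to : (from ∘Q to) ≈Q idQ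
    to∘from : (to ∘Q from) ≈Q idQ
open QIso public

P₁ : Quiver
P₁ = record { V = Bool ; E = ⊤ ; src = λ _ → false ; tgt = λ _ → true }

_×Q_ : Quiver → Quiver → Quiver
Q ×Q R = record
  { V = V Q × V R
  ; E = E Q × E R
  ; src = λ { (e , d) → (src Q e , src R d) }
  ; tgt = λ { (e , d) → (tgt Q e , tgt R d) }
  }

_×h_ : ∀ {Q Q' R R'} → QHom Q Q' → QHom R R' → QHom (Q ×Q R) (Q' ×Q R')
f ×h g = record
  { hV = λ { (v , w) → (hV f v , hV g w) }
  ; hE = λ { (e , d) → (hE f e , hE g d) }
  ; hsrc = λ { (e , d) → cong₂' (hsrc f e) (hsrc g d) }
  ; htgt = λ { (e , d) → cong₂' (htgt f e) (htgt g d) }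
  }
  where
  cong₂' : ∀ {A B : Set} {a a' : A} {b b' : B} → a ≡ a' → b ≡ b' → (a , b) ≡ (a' , b')
  cong₂' refl refl = refl

record Exponential (Q P : Quiver) : Set₂ where
  field
    obj     : Quiver
    ev      : QHom (obj ×Q P) Q
    curry   : ∀ {Z : Quiver} → QHom (Z ×Q P) Q → QHom Z obj
    β       : ∀ {Z : Quiver} (f : QHom (Z ×Q P) Q) →
              (ev ∘Q (curry f ×h idQ)) ≈Q f
    unique  : ∀ {Z : Quiver} (f : QHom (Z ×Q P) Q) (g : QHom Z obj) →
              (ev ∘Q (g ×h idQ)) ≈Q f → g ≈Q curry f
open Exponential public

expMap : ∀ {Q R P} (XQ : Exponential Q P) (XR : Exponential R P) →
         QHom Q R → QHom (obj XQ) (obj XR)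
expMap XQ XR φ = curry XR (φ ∘Q ev XQ)

record IncHyp : Set₁ where
  field
    Vc : Set
    Ec : Set
    I  : Set
    ς  : I → Vc
    ω  : I → Ec
open IncHyp public

record RHom (G H : IncHyp) : Set where
  field
    mV : Vc G → Vc H
    mE : Ec G → Ec H
    mI : I G → I H
    mς : ∀ i → mV (ς G i) ≡ ς H (mI i)
    mω : ∀ i → mE (ω G i) ≡ ω H (mI i)
open RHom public

Υ : Quiver → IncHyp
Υ Q = record { Vc = V Q ; Ec = V Q ; I = E Q ; ς = src Q ; ω = tgt Q }

Υhom : ∀ {Q R} → QHom Q R → RHom (Υ Q) (Υ R)
Υhom φ = record { mV = hV φ ; mE = hV φ ; mI = hE φ ; mς = hsrc φ ; mω = htgt φ }

Υ⋄ : IncHyp → Quiver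
Υ⋄ G = record
  { V = Vc G ⊎ Ec G
  ; E = I G
  ; src = λ i → inj₁ (ς G i)
  ; tgt = λ i → inj₂ (ω G i)
  }

Υ⋄hom : ∀ {G H} → RHom G H → QHom (Υ⋄ G) (Υ⋄ H)
Υ⋄hom m = record
  { hV = λ { (inj₁ v) → inj₁ (mV m v) ; (inj₂ e) → inj₂ (mE m e) }
  ; hE = mI m
  ; hsrc = λ i → cong inj₁ (mς m i)
  ; htgt = λ i → cong inj₂ (mω m i)
  }

Υ⋆ : IncHyp → Quiver
Υ⋆ G = record
  { V = Vc G × Ec G
  ; E = Vc G × I G × Ec G
  ; src = λ { (v , i , e) → (ς G i , e) }
  ; tgt = λ { (v , i , e) → (v , ω G i) }
  }

Υ⋆hom : ∀ {G H} → RHom G H → QHom (Υ⋆ G) (Υ⋆ H)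
Υ⋆hom m = record
  { hV = λ { (v , e) → (mV m v , mE m e) }
  ; hE = λ { (v , i , e) → (mV m v , mI m i , mE m e) }
  ; hsrc = λ { (v , i , e) → pair (mς m i) refl }
  ; htgt = λ { (v , i , e) → pair refl (mω m i) }
  }
  where
  pair : ∀ {A B : Set} {a a' : A} {b b' : B} → a ≡ a' → b ≡ b' → (a , b) ≡ (a' , b')
  pair refl refl = refl

-- Part (1) is a direct computation: the vertices of Υ⋄Υ(Q) are two tagged
-- copies of V(Q), i.e. V(Q) × {false, true}, and every edge goes from the
-- 'false' copy to the 'true' copy, exactly as in Q × P₁.
--
-- Part (2) must hold for an ARBITRARY choice of exponentials, so it is
-- reduced to the universal property.
-- From this, any two exponentials of Q by P are isomorphic via the
-- comparison map curry(ev), and these comparisons commute with every map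
-- that transposes φ ∘ ev.  Then we show that Υ⋆Υ(Q) together with an
-- explicit evaluation map IS an exponential of Q by P₁, and that Υ⋆Υ(φ)
-- transposes φ ∘ ev; the theorem follows by comparing with the given X.
module Submission where

open import Defs
open import Data.Product using (Σ; _×_; _,_; proj₁; proj₂)
open import Data.Sum using (inj₁; inj₂)
open import Data.Bool using (false; true)
open import Data.Unit using (tt)
open import Relation.Binary.PropositionalEquality

-- Equality of quiver morphisms, wrapped in a record so that the two
-- morphisms it relates are recoverable from its type by unification.
record _≋_ {Q R : Quiver} (f g : QHom Q R) : Set where
  constructor mk≋
  field agree : f ≈Q g
open _≋_

≋-refl : ∀ {Q R} {f : QHom Q R} → f ≋ f
≋-refl = mk≋ ((λ _ → refl) , (λ _ → refl))

≋-sym : ∀ {Q R} {f g : QHom Q R} → f ≋ g → g ≋ f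
≋-sym (mk≋ (pV , pE)) = mk≋ ((λ v → sym (pV v)) , (λ e → sym (pE e)))

≋-trans : ∀ {Q R} {f g h : QHom Q R} → f ≋ g → g ≋ h → f ≋ h
≋-trans (mk≋ (pV , pE)) (mk≋ (qV , qE)) =
  mk≋ ((λ v → trans (pV v) (qV v)) , (λ e → trans (pE e) (qE e)))

∘Q-congˡ : ∀ {P Q R} (φ : QHom Q R) {f g : QHom P Q} → f ≋ g → (φ ∘Q f) ≋ (φ ∘Q g)
∘Q-congˡ φ (mk≋ (pV , pE)) = mk≋ ((λ v → cong (hV φ) (pV v)) , (λ e → cong (hE φ) (pE e)))

∘Q-congʳ : ∀ {P Q R} {f g : QHom Q R} (h : QHom P Q) → f ≋ g → (f ∘Q h) ≋ (g ∘Q h)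
∘Q-congʳ h (mk≋ (pV , pE)) = mk≋ ((λ v → pV (hV h v)) , (λ e → pE (hE h e)))

∘Q-assoc : ∀ {O P Q R} (h : QHom Q R) (g : QHom P Q) (f : QHom O P) →
           ((h ∘Q g) ∘Q f) ≋ (h ∘Q (g ∘Q f))
∘Q-assoc h g f = mk≋ ((λ _ → refl) , (λ _ → refl))

module _ {Q P : Quiver} (X : Exponential Q P) where

  Transposes : ∀ {Z} → QHom Z (obj X) → QHom (Z ×Q P) Q → Set
  Transposes g f = (ev X ∘Q (g ×h idQ)) ≋ f

  curry-transposes : ∀ {Z} (f : QHom (Z ×Q P) Q) → Transposes (curry X f) f
  curry-transposes f = mk≋ (β X f)

  transpose-unique : ∀ {Z} {f : QHom (Z ×Q P) Q} {g h : QHom Z (obj X)} →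
                     Transposes g f → Transposes h f → g ≋ h
  transpose-unique {f = f} {g} {h} (mk≋ pg) (mk≋ ph) =
    ≋-trans (mk≋ {g = curry X f} (unique X f g pg)) (≋-sym (mk≋ (unique X f h ph)))

  -- Precomposing a transpose of f with h gives a transpose of f ∘ (h × id);
  -- on vertices and edges, (g ∘ h) × id computes as (g × id) ∘ (h × id).
  transpose-∘ : ∀ {Z Z'} {g : QHom Z (obj X)} {f : QHom (Z ×Q P) Q} (h : QHom Z' Z) →
                Transposes g f → Transposes (g ∘Q h) (f ∘Q (h ×h idQ))
  transpose-∘ h p = mk≋ (agree (∘Q-congʳ (h ×h idQ) p))

module Comparison {Q P : Quiver} (A B : Exponential Q P) where

  compare : QHom (obj A) (obj B)
  compare = curry B (ev A)

  compare-transposes : ∀ {Z} {m : QHom Z (obj A)} {f : QHom (Z ×Q P) Q} →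
                       Transposes A m f → Transposes B (compare ∘Q m) f
  compare-transposes {m = m} pm = ≋-trans (transpose-∘ B m (curry-transposes B (ev A))) pm

open Comparison using (compare; compare-transposes)

-- Any two exponentials of Q by P are isomorphic via the comparison maps:
-- both composites transpose ev, as does the identity.
exponential-iso : ∀ {Q P} (A B : Exponential Q P) → QIso (obj A) (obj B)
exponential-iso A B = record
  { to      = compare A B
  ; from    = compare B A
  ; from∘to = agree (transpose-unique A (compare-transposes B A (curry-transposes B (ev A))) ≋-refl)
  ; to∘from = agree (transpose-unique B (compare-transposes A B (curry-transposes A (ev B))) ≋-refl)
  }

compare-natural : ∀ {Q R P} (A A' : Exponential Q P) (B B' : Exponential R P)
                  (φ : QHom Q R) (m : QHom (obj A) (obj B)) →
                  Transposes B m (φ ∘Q ev A) →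
                  (compare B B' ∘Q m) ≋ (expMap A' B' φ ∘Q compare A A')
compare-natural A A' B B' φ m pm =
  transpose-unique B' (compare-transposes B B' pm) expMap-after-compare
  where
  -- expMap A' B' φ transposes φ ∘ ev A', and compare A A' turns ev A' into ev A.
  expMap-after-compare : Transposes B' (expMap A' B' φ ∘Q compare A A') (φ ∘Q ev A)
  expMap-after-compare =
    ≋-trans (transpose-∘ B' (compare A A') (curry-transposes B' (φ ∘Q ev A')))
            (≋-trans (∘Q-assoc φ (ev A') (compare A A' ×h idQ))
                     (∘Q-congˡ φ (curry-transposes A' (ev A))))

module Diamond (Q : Quiver) where

  layer : V (Υ⋄ (Υ Q)) → V (Q ×Q P₁)
  layer (inj₁ v) = v , false
  layer (inj₂ v) = v , true

  unlayer : V (Q ×Q P₁) → V (Υ⋄ (Υ Q))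
  unlayer (v , false) = inj₁ v
  unlayer (v , true)  = inj₂ v

  unlayer-layer : ∀ x → unlayer (layer x) ≡ x
  unlayer-layer (inj₁ v) = refl
  unlayer-layer (inj₂ v) = refl

  layer-unlayer : ∀ x → layer (unlayer x) ≡ x
  layer-unlayer (v , false) = refl
  layer-unlayer (v , true)  = refl

  -- Edges correspond since P₁ has exactly one edge, from false to true.
  iso : QIso (Υ⋄ (Υ Q)) (Q ×Q P₁)
  iso = record
    { to      = record { hV = layer ; hE = λ e → e , tt ; hsrc = λ _ → refl ; htgt = λ _ → refl }
    ; from    = record { hV = unlayer ; hE = proj₁ ; hsrc = λ _ → refl ; htgt = λ _ → refl }
    ; from∘to = unlayer-layer , (λ _ → refl)
    ; to∘from = layer-unlayer , (λ _ → refl)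
    }

diamond-natural : ∀ {Q R : Quiver} (φ : QHom Q R) →
                  (to (Diamond.iso R) ∘Q Υ⋄hom (Υhom φ)) ≈Q ((φ ×h idQ) ∘Q to (Diamond.iso Q))
diamond-natural φ = (λ { (inj₁ v) → refl ; (inj₂ v) → refl }) , (λ _ → refl)

-- A vertex (a , b) of Υ⋆Υ(Q) is
-- the map P₁-vertices → V(Q) sending false ↦ a, true ↦ b; an edge (v , i , w)
-- carries an edge i of Q as the image of the edge of P₁.

module Star (Q : Quiver) where

  evV : V (Υ⋆ (Υ Q) ×Q P₁) → V Q
  evV ((a , b) , false) = a
  evV ((a , b) , true)  = b

  evaluation : QHom (Υ⋆ (Υ Q) ×Q P₁) Q
  evaluation = record
    { hV   = evV
    ; hE   = λ { ((v , i , w) , tt) → i }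
    ; hsrc = λ { ((v , i , w) , tt) → refl }
    ; htgt = λ { ((v , i , w) , tt) → refl }
    }

  -- The transpose of f : Z × P₁ → Q sends a vertex z to its two images
  -- f (z , false), f (z , true), and an edge d to its image f (d , tt)
  -- together with f (tgt d , false) and f (src d , true), the two vertex
  -- images not already fixed by the endpoints of f (d , tt).
  transpose : ∀ {Z : Quiver} → QHom (Z ×Q P₁) Q → QHom Z (Υ⋆ (Υ Q))
  transpose {Z} f = record
    { hV   = λ z → hV f (z , false) , hV f (z , true)
    ; hE   = λ d → hV f (tgt Z d , false) , hE f (d , tt) , hV f (src Z d , true)
    ; hsrc = λ d → cong₂ _,_ (hsrc f (d , tt)) refl
    ; htgt = λ d → cong₂ _,_ refl (htgt f (d , tt))
    }

  transpose-β : ∀ {Z : Quiver} (f : QHom (Z ×Q P₁) Q) →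
                (evaluation ∘Q (transpose f ×h idQ)) ≈Q f
  transpose-β f = (λ { (z , false) → refl ; (z , true) → refl }) , (λ { (d , tt) → refl })

  -- A morphism g is determined by its evaluations: each coordinate of g on
  -- an edge d is read off from f at d or, via the source/target equations
  -- of g, from f at an endpoint of d.
  transpose-determined : ∀ {Z : Quiver} (f : QHom (Z ×Q P₁) Q) (g : QHom Z (Υ⋆ (Υ Q))) →
                      (evaluation ∘Q (g ×h idQ)) ≈Q f → g ≈Q transpose f
  transpose-determined {Z} f g (pV , pE) = onVertices , onEdges
    where
    onVertices : ∀ z → hV g z ≡ hV (transpose f) z
    onVertices z = cong₂ _,_ (pV (z , false)) (pV (z , true))

    onEdges : ∀ d → hE g d ≡ hE (transpose f) d
    onEdges d = cong₂ _,_
      (trans (sym (cong proj₁ (htgt g d))) (pV (tgt Z d , false)))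
      (cong₂ _,_ (pE (d , tt))
                 (trans (sym (cong proj₂ (hsrc g d))) (pV (src Z d , true))))

  exponential : Exponential Q P₁
  exponential = record
    { obj = Υ⋆ (Υ Q) ; ev = evaluation ; curry = transpose
    ; β = transpose-β ; unique = transpose-determined
    }

-- Υ⋆Υ(φ) lies over φ, so it is the functorial action of (-)^P₁ on φ.
star-transposes : ∀ {Q R : Quiver} (φ : QHom Q R) →
                  Transposes (Star.exponential R) (Υ⋆hom (Υhom φ)) (φ ∘Q Star.evaluation Q)
star-transposes φ = mk≋ ((λ { (x , false) → refl ; (x , true) → refl }) , (λ { (x , tt) → refl }))

mainTheorem19 : Σ ((Q : Quiver) → QIso (Υ⋄ (Υ Q)) (Q ×Q P₁)) (λ ψ →
    ∀ {Q R : Quiver} (φ : QHom Q R) →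
    (to (ψ R) ∘Q Υ⋄hom (Υhom φ)) ≈Q ((φ ×h idQ) ∘Q to (ψ Q)))
    ×
    ((X : (Q : Quiver) → Exponential Q P₁) →
    Σ ((Q : Quiver) → QIso (Υ⋆ (Υ Q)) (obj (X Q))) (λ ψ →
    ∀ {Q R : Quiver} (φ : QHom Q R) →
    (to (ψ R) ∘Q Υ⋆hom (Υhom φ)) ≈Q (expMap (X Q) (X R) φ ∘Q to (ψ Q))))
mainTheorem19 =
    (Diamond.iso , diamond-natural)
  , λ X → (λ Q → exponential-iso (Star.exponential Q) (X Q))
        , λ {Q} {R} φ → agree (compare-natural (Star.exponential Q) (X Q) (Star.exponential R) (X R)
                                               φ (Υ⋆hom (Υhom φ)) (star-transposes φ))
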